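{- Let $h\geq 4$ be an integer. Let $A=\{a_1,a_2,\ldots,a_{h+1}\}$ be a set of nonnegative integers such that $0=a_1<a_2<\cdots<a_{h+1}$. Assume that $a_3\equiv a_2 \pmod 2$ and $a_r\not\equiv a_2\pmod 2$ for some $r\in[4,h+1]$. Then \[ |h^{\wedge}_{\pm}A| \geq |h^{\wedge}_{\pm}A_r| + \frac{h(h-1)}{2} + 2h + 1, \] where $A_r = A\setminus\{a_r\}$. Hence $|h^{\wedge}_{\pm}A|\geq h^2+h+2$.
   Context: For a finite set $A=\{a_1,\ldots,a_k\}$ of integers and a positive integer $h$, the restricted $h$-fold signed sumset is $h^{\wedge}_{\pm}A=\left\{\sum_{i=1}^{k}\lambda_i a_i : \lambda_i\in\{ -1,0,1\} \text{ for all } i,\ \sum_{i=1}^{k}|\lambda_i| = h\right\}$. For integers $a\le b$, $[a,b]=\{n\in\mathbb{Z}:a\le n\le b\}$. -}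

module Defs where

open import Data.Nat using (ℕ; zero; suc)
open import Data.Integer using (ℤ; _+_; -_; +_)
import Data.Integer as ℤ
open import Data.List using (List; []; _∷_; _++_; map; length; deduplicate)

-- Restricted h-fold signed sums of a list of integers, as a list (with
-- repetitions): all Σ λᵢ aᵢ with λᵢ ∈ {-1,0,1} and exactly h nonzero λᵢ.
signedSums : ℕ → List ℤ → List ℤ
signedSums zero    []       = + 0 ∷ []
signedSums (suc h) []       = []
signedSums zero    (a ∷ as) = signedSums zero as
signedSums (suc h) (a ∷ as) =
  signedSums (suc h) as
  ++ map (λ s → a + s) (signedSums h as)
  ++ map (λ s → (- a) + s) (signedSums h as)

card-hSignedSumset : ℕ → List ℤ → ℕ
card-hSignedSumset h A = length (deduplicate ℤ._≟_ (signedSums h A))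

-- Put F = 0 ∷ a₂ ∷ a₃ ∷ B and R = F with aᵣ removed. Since |R| = h, every element of h^∧_± R is a
-- full signed sum of R: it lies in [-ΣR, ΣR] and is ≡ ΣR mod 2. Outside this set, h^∧_± F contains
-- ±ΣF (as ΣF = ΣR + aᵣ > ΣR) and all z + s with z ∈ {±a₂, ±a₃} and s a full signed sum of B
-- (omit 0 and one of a₂, a₃); since a₂ ≡ a₃, these are ≡ a₃ + ΣB = ΣR + (aᵣ − a₂) ≢ ΣR mod 2.
-- Adding the entries of B from the largest down, one finds 4(h − 1) + (h − 2)(h − 3)/2 strictly
-- increasing such sums. The same construction with {0} in place of {±a₂, ±a₃} gives
-- |h^∧_± R| ≥ h + (h − 1)(h − 2)/2, whence h² + h + 2.

module Submission where

open import Defs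
open import Data.Nat.Combinatorics using (_C_; nC1≡n; nCk+nC[k+1]≡[n+1]C[k+1])
open import Data.Nat.DivMod using (_/_; m*n/n≡m)
import Data.Nat.Properties as ℕ
import Data.Nat.Tactic.RingSolver as ℕ-Solver
open import Data.Integer using (ℤ; +_; _-_)
import Data.Integer as ℤ
import Data.Integer.Properties as ℤ
import Data.Integer.Divisibility.Signed as Signed
open import Data.List using (List; []; _∷_; _++_; [_]; map; foldr; length; reverse; filter; upTo; applyUpTo; deduplicate)
import Data.List.Properties as List
open import Data.List.Membership.Propositional using (_∈_)
open import Data.List.Membership.Propositional.Properties
  using (∈-++⁺ˡ; ∈-++⁺ʳ; ∈-++⁻; ∈-map⁺; ∈-map⁻; ∈-deduplicate⁺; ∈-deduplicate⁻; ∈-applyUpTo⁺)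
open import Data.List.Relation.Unary.Any using (here; there; index; _─_)
open import Data.List.Relation.Unary.Any.Properties using (reverse⁻)
open import Data.List.Relation.Unary.All as All using (All)
import Data.List.Relation.Unary.All.Properties as All
open import Data.List.Relation.Unary.AllPairs as AllPairs using (AllPairs; []; _∷_)
import Data.List.Relation.Unary.AllPairs.Properties as AllPairs
open import Data.List.Relation.Unary.Linked as Linked using ()
open import Data.List.Relation.Unary.Linked.Properties using (Linked⇒AllPairs)
open import Data.List.Relation.Unary.Unique.Propositional using (Unique)
import Data.List.Relation.Unary.Unique.Propositional.Properties as Unique
open import Data.List.Relation.Unary.Unique.DecPropositional.Properties using (deduplicate-!)
open import Data.List.Relation.Binary.Subset.Propositional using (_⊆_)
open import Data.List.Relation.Binary.Disjoint.Propositional using (Disjoint)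
open import Data.List.Relation.Binary.Sublist.Propositional using (_∷ʳ_; ⊆-refl)
  renaming (_⊆_ to _⊑_; [] to []ˢ; _∷_ to _∷ˢ_; ⊆-trans to ⊑-trans)
open import Data.List.Relation.Binary.Sublist.Propositional.Properties as Sublist using (to-≋; filter-⊆)
  renaming (All-resp-⊆ to All-resp-⊑)
open import Data.List.Relation.Binary.Equality.Propositional using (≋⇒≡)
open import Data.List.Relation.Binary.Permutation.Propositional as ↭
  using (_↭_; ↭-refl; ↭-prep; ↭-swap; ↭-trans; ↭-sym; ↭-reflexive; ↭⇒↭ₛ)
open import Data.List.Relation.Binary.Permutation.Propositional.Properties as ↭
  using (↭-reverse; ↭-length; All-resp-↭; ∈-resp-↭)
open import Data.List.Relation.Binary.Permutation.Setoid.Properties using (foldr-commMonoid)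
open import Data.Product using (_×_; _,_; proj₁; proj₂; ∃₂)
open import Data.Sum using (_⊎_; inj₁; inj₂)
open import Data.Empty using (⊥-elim)
open import Function using (_∘_; flip)
open import Relation.Binary.Definitions using (DecidableEquality)
open import Relation.Nullary using (¬_; ¬?)
open import Relation.Binary.PropositionalEquality hiding ([_])
import Data.Nat as ℕ

module _ {A : Set} where

  ∈-─ : ∀ {x y : A} {ys} (x∈ys : x ∈ ys) → y ∈ ys → y ≢ x → y ∈ (ys ─ x∈ys)
  ∈-─ (here refl)  (here refl)  y≢x = ⊥-elim (y≢x refl)
  ∈-─ (here refl)  (there y∈ys) _   = y∈ys
  ∈-─ (there _)    (here refl)  _   = here refl
  ∈-─ (there x∈ys) (there y∈ys) y≢x = there (∈-─ x∈ys y∈ys y≢x)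

  Unique-length-≤ : ∀ {xs ys : List A} → Unique xs → xs ⊆ ys → length xs ℕ.≤ length ys
  Unique-length-≤ {[]}          _              _      = ℕ.z≤n
  Unique-length-≤ {x ∷ xs} {ys} (x∉xs ∷ xs!) xs⊆ys = begin
    ℕ.suc (length xs)           ≤⟨ ℕ.s≤s (Unique-length-≤ xs! xs⊆ys─x) ⟩
    ℕ.suc (length (ys ─ x∈ys))  ≡⟨ List.length-removeAt′ ys (index x∈ys) ⟨
    length ys                   ∎
    where
    open ℕ.≤-Reasoning
    x∈ys = xs⊆ys (here refl)
    xs⊆ys─x : xs ⊆ (ys ─ x∈ys)
    xs⊆ys─x y∈xs = ∈-─ x∈ys (xs⊆ys (there y∈xs)) (All.lookup x∉xs y∈xs ∘ sym)

  AllPairs-reverse : ∀ {R : A → A → Set} {xs} → AllPairs R xs → AllPairs (flip R) (reverse xs)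
  AllPairs-reverse [] = []
  AllPairs-reverse {xs = x ∷ xs} (x<xs ∷ xs<) rewrite List.unfold-reverse x xs =
    AllPairs.++⁺ (AllPairs-reverse xs<) (All.[] ∷ [])
      (All.tabulate (λ y∈ → All.lookup x<xs (reverse⁻ y∈) All.∷ All.[]))

  module _ (_≟_ : DecidableEquality A) where

    deduplicate-length-+ : ∀ {xs ys us} → Unique us → us ⊆ ys → Disjoint xs us → xs ⊆ ys →
      length (deduplicate _≟_ xs) ℕ.+ length us ℕ.≤ length (deduplicate _≟_ ys)
    deduplicate-length-+ {xs} {ys} {us} us! us⊆ys xs∩us=∅ xs⊆ys = begin
      length (deduplicate _≟_ xs) ℕ.+ length us  ≡⟨ List.length-++ (deduplicate _≟_ xs) ⟨
      length (deduplicate _≟_ xs ++ us)          ≤⟨ Unique-length-≤ xs′++us! xs′++us⊆ys′ ⟩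
      length (deduplicate _≟_ ys)                ∎
      where
      open ℕ.≤-Reasoning
      xs′++us! : Unique (deduplicate _≟_ xs ++ us)
      xs′++us! = Unique.++⁺ (deduplicate-! _≟_ xs) us!
        (λ (v∈xs′ , v∈us) → xs∩us=∅ (∈-deduplicate⁻ _≟_ xs v∈xs′ , v∈us))
      xs′++us⊆ys′ : deduplicate _≟_ xs ++ us ⊆ deduplicate _≟_ ys
      xs′++us⊆ys′ v∈ with ∈-++⁻ (deduplicate _≟_ xs) v∈
      ... | inj₁ v∈xs′ = ∈-deduplicate⁺ _≟_ (xs⊆ys (∈-deduplicate⁻ _≟_ xs v∈xs′))
      ... | inj₂ v∈us  = ∈-deduplicate⁺ _≟_ (us⊆ys v∈us)

    ↭-∷-filter-≢ : ∀ {x xs} → Unique xs → x ∈ xs → xs ↭ x ∷ filter (λ y → ¬? (y ≟ x)) xs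
    ↭-∷-filter-≢ {x} {x ∷ xs} (x∉xs ∷ _) (here refl) = ↭-prep x (↭-reflexive (sym (begin
      filter P? (x ∷ xs)  ≡⟨ List.filter-reject P? (λ x≢x → x≢x refl) ⟩
      filter P? xs        ≡⟨ List.filter-all P? (All.map (_∘ sym) x∉xs) ⟩
      xs                  ∎)))
      where
      open ≡-Reasoning
      P? = λ y → ¬? (y ≟ x)
    ↭-∷-filter-≢ {x} {y ∷ xs} (y∉xs ∷ xs!) (there x∈xs) =
      ↭-trans (↭-prep y (↭-∷-filter-≢ xs! x∈xs))
        (↭-trans (↭-swap y x ↭-refl)
          (↭-reflexive (cong (x ∷_) (sym (List.filter-accept P? (All.lookup y∉xs x∈xs))))))
      where P? = λ y → ¬? (y ≟ x)

[n+1]C2≡n+nC2 : ∀ n → ℕ.suc n C 2 ≡ n ℕ.+ n C 2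
[n+1]C2≡n+nC2 n = begin
  ℕ.suc n C 2        ≡⟨ nCk+nC[k+1]≡[n+1]C[k+1] n 1 ⟨
  n C 1 ℕ.+ n C 2    ≡⟨ cong (ℕ._+ n C 2) (nC1≡n n) ⟩
  n ℕ.+ n C 2        ∎
  where open ≡-Reasoning

module _ where

  open import Data.Nat using (ℕ; zero; suc; z≤n)
  open import Data.Integer using (0ℤ; -[1+_]; +≤+; -_; _+_; _≤_; _<_; _>_)
  open import Data.Integer.Properties
  open import Data.Integer.Divisibility.Signed using (_∣_; divides; ∣m∣n⇒∣m+n; ∣m∣n⇒∣m-n; ∣m⇒∣-m)
  open import Data.Integer.Tactic.RingSolver using (solve; solve-∀)
  open import Algebra.Properties.CommutativeSemigroup +-commutativeSemigroup using (x∙yz≈y∙xz)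

  private
    variable
      x y s : ℤ
      xs ys L L′ : List ℤ
      n : ℕ

  sumℤ : List ℤ → ℤ
  sumℤ = foldr _+_ 0ℤ

  sumℤ-↭ : xs ↭ ys → sumℤ xs ≡ sumℤ ys
  sumℤ-↭ p = foldr-commMonoid (setoid ℤ) +-0-isCommutativeMonoid (↭⇒↭ₛ p)

  2∣x+x : ∀ x → + 2 ∣ x + x
  2∣x+x x = divides x (solve (x ∷ []))

  0≤i⇒-i≤i : 0ℤ ≤ x → - x ≤ x
  0≤i⇒-i≤i 0≤x = ≤-trans (neg-mono-≤ 0≤x) 0≤x

  -i≤i⇒0≤i : - x ≤ x → 0ℤ ≤ x
  -i≤i⇒0≤i {+ _}      _  = +≤+ z≤n
  -i≤i⇒0≤i { -[1+ _ ]} ()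

  data FullSignedSum : List ℤ → ℤ → Set where
    []  : FullSignedSum [] 0ℤ
    +∷_ : ∀ {a as s} → FullSignedSum as s → FullSignedSum (a ∷ as) (a + s)
    -∷_ : ∀ {a as s} → FullSignedSum as s → FullSignedSum (a ∷ as) (- a + s)

  FullSignedSum-↭ : xs ↭ ys → FullSignedSum xs s → FullSignedSum ys s
  FullSignedSum-↭ ↭.refl         f         = f
  FullSignedSum-↭ (↭.prep _ p)   (+∷ f)    = +∷ FullSignedSum-↭ p f
  FullSignedSum-↭ (↭.prep _ p)   (-∷ f)    = -∷ FullSignedSum-↭ p f
  FullSignedSum-↭ (↭.swap x y p) (+∷ +∷ f) = subst (FullSignedSum _) (x∙yz≈y∙xz y x _) (+∷ +∷ FullSignedSum-↭ p f)
  FullSignedSum-↭ (↭.swap x y p) (+∷ -∷ f) = subst (FullSignedSum _) (x∙yz≈y∙xz (- y) x _) (-∷ +∷ FullSignedSum-↭ p f)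
  FullSignedSum-↭ (↭.swap x y p) (-∷ +∷ f) = subst (FullSignedSum _) (x∙yz≈y∙xz y (- x) _) (+∷ -∷ FullSignedSum-↭ p f)
  FullSignedSum-↭ (↭.swap x y p) (-∷ -∷ f) =
    subst (FullSignedSum _) (x∙yz≈y∙xz (- y) (- x) _) (-∷ -∷ FullSignedSum-↭ p f)
  FullSignedSum-↭ (↭.trans p q)  f         = FullSignedSum-↭ q (FullSignedSum-↭ p f)

  FullSignedSum-sum : ∀ L → FullSignedSum L (sumℤ L)
  FullSignedSum-sum []      = []
  FullSignedSum-sum (_ ∷ L) = +∷ FullSignedSum-sum L

  FullSignedSum-neg-sum : ∀ L → FullSignedSum L (- sumℤ L)
  FullSignedSum-neg-sum []      = []
  FullSignedSum-neg-sum (a ∷ L) =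
    subst (FullSignedSum _) (sym (neg-distrib-+ a (sumℤ L))) (-∷ FullSignedSum-neg-sum L)

  FullSignedSum-flip : ∀ {c} → c ∈ L → FullSignedSum L (sumℤ L - (c + c))
  FullSignedSum-flip {c ∷ L} (here refl) =
    subst (FullSignedSum _) (flip-head c (sumℤ L)) (-∷ FullSignedSum-sum L)
    where
    flip-head : ∀ c S → - c + S ≡ (c + S) - (c + c)
    flip-head = solve-∀
  FullSignedSum-flip {a ∷ L} {c} (there c∈L) =
    subst (FullSignedSum _) (flip-tail a (sumℤ L) c) (+∷ FullSignedSum-flip c∈L)
    where
    flip-tail : ∀ a S c → a + (S - (c + c)) ≡ (a + S) - (c + c)
    flip-tail = solve-∀

  FullSignedSum-parity : FullSignedSum L s → + 2 ∣ sumℤ L - s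
  FullSignedSum-parity [] = divides 0ℤ refl
  FullSignedSum-parity {a ∷ L} (+∷_ {s = s} f) = subst (+ 2 ∣_) (plus a (sumℤ L) s) (FullSignedSum-parity f)
    where
    plus : ∀ a S s → S - s ≡ (a + S) - (a + s)
    plus = solve-∀
  FullSignedSum-parity {a ∷ L} (-∷_ {s = s} f) =
    subst (+ 2 ∣_) (minus a (sumℤ L) s) (∣m∣n⇒∣m+n (FullSignedSum-parity f) (2∣x+x a))
    where
    minus : ∀ a S s → (S - s) + (a + a) ≡ (a + S) - (- a + s)
    minus = solve-∀

  sumℤ-nonNeg : All (0ℤ ≤_) L → 0ℤ ≤ sumℤ L
  sumℤ-nonNeg All.[]          = ≤-refl
  sumℤ-nonNeg (0≤a All.∷ 0≤L) = +-mono-≤ 0≤a (sumℤ-nonNeg 0≤L)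

  FullSignedSum-bounded : All (0ℤ ≤_) L → FullSignedSum L s → - sumℤ L ≤ s × s ≤ sumℤ L
  FullSignedSum-bounded All.[] [] = ≤-refl , ≤-refl
  FullSignedSum-bounded {a ∷ L} (0≤a All.∷ 0≤L) (+∷ f) with FullSignedSum-bounded 0≤L f
  ... | lower , upper =
    subst (_≤ _) (sym (neg-distrib-+ a (sumℤ L))) (+-mono-≤ (0≤i⇒-i≤i 0≤a) lower) ,
    +-monoʳ-≤ a upper
  FullSignedSum-bounded {a ∷ L} (0≤a All.∷ 0≤L) (-∷ f) with FullSignedSum-bounded 0≤L f
  ... | lower , upper =
    subst (_≤ _) (sym (neg-distrib-+ a (sumℤ L))) (+-monoʳ-≤ (- a) lower) ,
    +-mono-≤ (0≤i⇒-i≤i 0≤a) upper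

  ∈-signedSums-∷⁻ : ∀ n a L → x ∈ signedSums (suc n) (a ∷ L) →
    x ∈ signedSums (suc n) L ⊎ ∃₂ λ y (_ : y ∈ signedSums n L) → x ≡ a + y ⊎ x ≡ - a + y
  ∈-signedSums-∷⁻ n a L x∈ with ∈-++⁻ (signedSums (suc n) L) x∈
  ... | inj₁ x∈′ = inj₁ x∈′
  ... | inj₂ x∈″ with ∈-++⁻ (map (λ s → a + s) (signedSums n L)) x∈″
  ...   | inj₁ x∈₊ = let y , y∈ , x≡ = ∈-map⁻ _ x∈₊ in inj₂ (y , y∈ , inj₁ x≡)
  ...   | inj₂ x∈₋ = let y , y∈ , x≡ = ∈-map⁻ _ x∈₋ in inj₂ (y , y∈ , inj₂ x≡)

  ∈-signedSums-skip : ∀ n {a} → x ∈ signedSums n L → x ∈ signedSums n (a ∷ L)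
  ∈-signedSums-skip zero    x∈ = x∈
  ∈-signedSums-skip (suc n) x∈ = ∈-++⁺ˡ x∈

  ∈-signedSums⁺ : L′ ⊑ L → FullSignedSum L′ x → x ∈ signedSums (length L′) L
  ∈-signedSums⁺ []ˢ [] = here refl
  ∈-signedSums⁺ {L′} (_ ∷ʳ L′⊑L) f = ∈-signedSums-skip (length L′) (∈-signedSums⁺ L′⊑L f)
  ∈-signedSums⁺ {_ ∷ L′} {a ∷ L} (refl ∷ˢ L′⊑L) (+∷ f) =
    ∈-++⁺ʳ (signedSums (suc (length L′)) L) (∈-++⁺ˡ (∈-map⁺ _ (∈-signedSums⁺ L′⊑L f)))
  ∈-signedSums⁺ {_ ∷ L′} {a ∷ L} (refl ∷ˢ L′⊑L) (-∷ f) =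
    ∈-++⁺ʳ (signedSums (suc (length L′)) L)
      (∈-++⁺ʳ (map (λ s → a + s) (signedSums (length L′) L)) (∈-map⁺ _ (∈-signedSums⁺ L′⊑L f)))

  SignedSum : ℕ → List ℤ → ℤ → Set
  SignedSum h L x = ∃₂ λ L′ (_ : L′ ⊑ L) → length L′ ≡ h × FullSignedSum L′ x

  SignedSum-∷ʳ : ∀ a → SignedSum n L x → SignedSum n (a ∷ L) x
  SignedSum-∷ʳ a (L′ , L′⊑L , |L′| , f) = L′ , a ∷ʳ L′⊑L , |L′| , f

  ∈-signedSums⁻ : ∀ n L → x ∈ signedSums n L → SignedSum n L x
  ∈-signedSums⁻ zero    []      (here refl) = [] , []ˢ , refl , []
  ∈-signedSums⁻ zero    (a ∷ L) x∈ = SignedSum-∷ʳ a (∈-signedSums⁻ zero L x∈)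
  ∈-signedSums⁻ (suc n) (a ∷ L) x∈ with ∈-signedSums-∷⁻ n a L x∈
  ... | inj₁ x∈′ = SignedSum-∷ʳ a (∈-signedSums⁻ (suc n) L x∈′)
  ... | inj₂ (y , y∈ , inj₁ refl) with ∈-signedSums⁻ n L y∈
  ...   | L′ , L′⊑L , refl , f = a ∷ L′ , refl ∷ˢ L′⊑L , refl , +∷ f
  ∈-signedSums⁻ (suc n) (a ∷ L) x∈ | inj₂ (y , y∈ , inj₂ refl) with ∈-signedSums⁻ n L y∈
  ...   | L′ , L′⊑L , refl , f = a ∷ L′ , refl ∷ˢ L′⊑L , refl , -∷ f

  ∈-signedSums-full⁻ : x ∈ signedSums (length L) L → FullSignedSum L x
  ∈-signedSums-full⁻ {L = L} x∈ with ∈-signedSums⁻ (length L) L x∈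
  ... | L′ , L′⊑L , |L′|≡|L| , f = subst (λ L → FullSignedSum L _) (≋⇒≡ (to-≋ |L′|≡|L| L′⊑L)) f

  signedSums-⊑ : L′ ⊑ L → signedSums n L′ ⊆ signedSums n L
  signedSums-⊑ {n = n} L′⊑L x∈ with ∈-signedSums⁻ n _ x∈
  ... | _ , L″⊑L′ , refl , f = ∈-signedSums⁺ (⊑-trans L″⊑L′ L′⊑L) f

  module Chain (β : ℤ) (Z : List ℤ) where

    flipped : ℤ → ℤ → ℤ → ℤ
    flipped M S c = β + (M + (S - (c + c)))

    -- If D is strictly decreasing with entries > β, and Z is increasing inside [-β, β] with β ∈ Z,
    -- then for the head M the three blocks are increasing and separated by flipped M ΣD M = β + ΣD - M.
    chain : List ℤ → List ℤ
    chain []      = Z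
    chain (M ∷ D) = map (λ y → - M + y) (chain D)
                 ++ map (flipped M (sumℤ D)) D
                 ++ map (λ z → z + (M + sumℤ D)) Z

    length-chain : ∀ D → length (chain D) ≡ length Z ℕ.* suc (length D) ℕ.+ length D C 2
    length-chain []      = sym (trans (ℕ.+-identityʳ _) (ℕ.*-identityʳ _))
    length-chain (M ∷ D) = begin
      length (chain (M ∷ D))                            ≡⟨ blocks ⟩
      length (chain D) ℕ.+ (length D ℕ.+ length Z)       ≡⟨ cong (ℕ._+ _) (length-chain D) ⟩
      length Z ℕ.* suc k ℕ.+ k C 2 ℕ.+ (k ℕ.+ length Z)  ≡⟨ regroup (length Z) k (k C 2) ⟩
      length Z ℕ.* suc (suc k) ℕ.+ (k ℕ.+ k C 2)         ≡⟨ cong (length Z ℕ.* suc (suc k) ℕ.+_) ([n+1]C2≡n+nC2 k) ⟨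
      length Z ℕ.* suc (suc k) ℕ.+ suc k C 2             ∎
      where
      open ≡-Reasoning
      k = length D
      blocks : length (chain (M ∷ D)) ≡ length (chain D) ℕ.+ (length D ℕ.+ length Z)
      blocks = trans (List.length-++ (map _ (chain D)))
        (cong₂ ℕ._+_ (List.length-map _ (chain D))
          (trans (List.length-++ (map _ D)) (cong₂ ℕ._+_ (List.length-map _ D) (List.length-map _ Z))))
      regroup : ∀ z k x → z ℕ.* suc k ℕ.+ x ℕ.+ (k ℕ.+ z) ≡ z ℕ.* suc (suc k) ℕ.+ (k ℕ.+ x)
      regroup = ℕ-Solver.solve-∀

    chain-elements : β ∈ Z → ∀ {D y} → y ∈ chain D →
      ∃₂ λ z s → z ∈ Z × FullSignedSum D s × y ≡ z + s
    chain-elements β∈Z {[]} {y} y∈Z = y , 0ℤ , y∈Z , [] , sym (+-identityʳ y)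
    chain-elements β∈Z {M ∷ D} y∈ with ∈-++⁻ (map (λ y → - M + y) (chain D)) y∈
    ... | inj₁ y∈shifted with ∈-map⁻ _ y∈shifted
    ...   | y′ , y′∈ , refl with chain-elements β∈Z y′∈
    ...     | z , s , z∈Z , f , refl = z , - M + s , z∈Z , -∷ f , x∙yz≈y∙xz (- M) z s
    chain-elements β∈Z {M ∷ D} y∈ | inj₂ y∈rest with ∈-++⁻ (map (flipped M (sumℤ D)) D) y∈rest
    ... | inj₁ y∈flipped = let c , c∈D , y≡ = ∈-map⁻ _ y∈flipped in
      β , M + (sumℤ D - (c + c)) , β∈Z , +∷ FullSignedSum-flip c∈D , y≡
    ... | inj₂ y∈lifted = let z , z∈Z , y≡ = ∈-map⁻ _ y∈lifted in
      z , M + sumℤ D , z∈Z , +∷ FullSignedSum-sum D , y≡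

    chain-bounded : β ∈ Z → All (λ z → - β ≤ z × z ≤ β) Z → ∀ {D y} → All (0ℤ ≤_) D → y ∈ chain D →
      - (β + sumℤ D) ≤ y × y ≤ β + sumℤ D
    chain-bounded β∈Z Z≤β {D} 0≤D y∈ with chain-elements β∈Z y∈
    ... | z , s , z∈Z , f , refl with All.lookup Z≤β z∈Z | FullSignedSum-bounded 0≤D f
    ...   | -β≤z , z≤β | -S≤s , s≤S =
      subst (_≤ z + s) (sym (neg-distrib-+ β (sumℤ D))) (+-mono-≤ -β≤z -S≤s) , +-mono-≤ z≤β s≤S

    flipped-anti : ∀ M S {c c′} → c < c′ → flipped M S c′ < flipped M S c
    flipped-anti M S c<c′ = +-monoʳ-< β (+-monoʳ-< M (+-monoʳ-< S (neg-mono-< (+-mono-< c<c′ c<c′))))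

    shifted≤flipped : ∀ M S {y} → y ≤ β + S → - M + y ≤ flipped M S M
    shifted≤flipped M S {y} y≤ = begin
      - M + y        ≤⟨ +-monoʳ-≤ (- M) y≤ ⟩
      - M + (β + S)  ≡⟨ solve (β ∷ M ∷ S ∷ []) ⟩
      β + (M + (S - (M + M))) ∎
      where open ≤-Reasoning

    flipped<lifted : ∀ M S {c z} → β < c → - β ≤ z → flipped M S c < z + (M + S)
    flipped<lifted M S {c} {z} β<c -β≤z = begin-strict
      β + (M + (S - (c + c)))  ≡⟨ solve (β ∷ M ∷ S ∷ c ∷ []) ⟩
      (β - (c + c)) + (M + S)  <⟨ +-monoˡ-< (M + S) (+-monoʳ-< β (neg-mono-< (+-mono-< β<c β<c))) ⟩
      (β - (β + β)) + (M + S)  ≡⟨ solve (β ∷ M ∷ S ∷ []) ⟩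
      - β + (M + S)            ≤⟨ +-monoˡ-≤ (M + S) -β≤z ⟩
      z + (M + S)              ∎
      where open ≤-Reasoning

    chain-sorted : β ∈ Z → AllPairs _<_ Z → All (λ z → - β ≤ z × z ≤ β) Z →
      ∀ {D} → AllPairs _>_ D → All (β <_) D → AllPairs _<_ (chain D)
    chain-sorted β∈Z Z< Z≤β []             All.[]           = Z<
    chain-sorted β∈Z Z< Z≤β {M ∷ D} (M>D ∷ D>) (β<M All.∷ β<D) =
      AllPairs.++⁺ shifted-sorted
        (AllPairs.++⁺ flipped-sorted lifted-sorted (All.map⁺ (All.map flipped<lifted-all β<D)))
        (All.map⁺ (All.tabulate shifted<rest))
      where
      S = sumℤ D
      lifted = map (λ z → z + (M + S)) Z

      shifted-sorted : AllPairs _<_ (map (λ y → - M + y) (chain D))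
      shifted-sorted = AllPairs.map⁺ (AllPairs.map (+-monoʳ-< (- M)) (chain-sorted β∈Z Z< Z≤β D> β<D))

      flipped-sorted : AllPairs _<_ (map (flipped M S) D)
      flipped-sorted = AllPairs.map⁺ (AllPairs.map (flipped-anti M S) D>)

      lifted-sorted : AllPairs _<_ lifted
      lifted-sorted = AllPairs.map⁺ (AllPairs.map (+-monoˡ-< (M + S)) Z<)

      flipped<lifted-all : ∀ {c} → β < c → All (flipped M S c <_) lifted
      flipped<lifted-all β<c = All.map⁺ (All.map (flipped<lifted M S β<c ∘ proj₁) Z≤β)

      0≤D : All (0ℤ ≤_) D
      0≤D = All.map (λ β<c → ≤-trans (-i≤i⇒0≤i (proj₁ (All.lookup Z≤β β∈Z))) (<⇒≤ β<c)) β<D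

      shifted<rest : ∀ {y} → y ∈ chain D → All (- M + y <_) (map (flipped M S) D ++ lifted)
      shifted<rest y∈ = All.++⁺
        (All.map⁺ (All.map (λ c<M → ≤-<-trans shifted≤pivot (flipped-anti M S c<M)) M>D))
        (All.map (≤-<-trans shifted≤pivot) (flipped<lifted-all β<M))
        where shifted≤pivot = shifted≤flipped M S (proj₂ (chain-bounded β∈Z Z≤β 0≤D y∈))

  card-hSignedSumset-0∷-≥ : AllPairs _<_ L → All (0ℤ <_) L →
    suc (length L) ℕ.+ length L C 2 ℕ.≤ card-hSignedSumset (suc (length L)) (0ℤ ∷ L)
  card-hSignedSumset-0∷-≥ {L} L< 0<L = begin
    suc (length L) ℕ.+ length L C 2  ≡⟨ |chain| ⟨
    length (chain (reverse L))       ≤⟨ Unique-length-≤ (AllPairs.map <⇒≢ chain<) chain⊆ ⟩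
    card-hSignedSumset (suc (length L)) (0ℤ ∷ L) ∎
    where
    open ℕ.≤-Reasoning
    open Chain 0ℤ [ 0ℤ ]
    |chain| : length (chain (reverse L)) ≡ suc (length L) ℕ.+ length L C 2
    |chain| = ≡.begin
      length (chain (reverse L))                ≡.≡⟨ length-chain (reverse L) ⟩
      1 ℕ.* suc (length (reverse L)) ℕ.+ length (reverse L) C 2
        ≡.≡⟨ cong (λ k → 1 ℕ.* suc k ℕ.+ k C 2) (List.length-reverse L) ⟩
      1 ℕ.* suc (length L) ℕ.+ length L C 2     ≡.≡⟨ cong (ℕ._+ length L C 2) (ℕ.*-identityˡ (suc (length L))) ⟩
      suc (length L) ℕ.+ length L C 2           ≡.∎
      where module ≡ = ≡-Reasoning
    chain< : AllPairs _<_ (chain (reverse L))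
    chain< = chain-sorted (here refl) (All.[] ∷ []) ((≤-refl , ≤-refl) All.∷ All.[])
      (AllPairs-reverse L<) (All-resp-↭ (↭-sym (↭-reverse L)) 0<L)
    chain⊆ : chain (reverse L) ⊆ deduplicate ℤ._≟_ (signedSums (suc (length L)) (0ℤ ∷ L))
    chain⊆ y∈ with chain-elements (here refl) y∈
    ... | _ , _ , here refl , f , refl =
      ∈-deduplicate⁺ ℤ._≟_ (∈-signedSums⁺ ⊆-refl (+∷_ {0ℤ} (FullSignedSum-↭ (↭-reverse L) f)))

  module OppositeParity {a₂ a₃ aᵣ : ℤ} {B Bᵣ : List ℤ}
    (0<a₂ : 0ℤ < a₂) (a₂<a₃ : a₂ < a₃) (B-sorted : AllPairs _<_ B) (a₃<B : All (a₃ <_) B)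
    (Bᵣ⊑B : Bᵣ ⊑ B) (B↭aᵣ∷Bᵣ : B ↭ aᵣ ∷ Bᵣ) (2∣a₃-a₂ : + 2 ∣ a₃ - a₂) (2∤aᵣ-a₂ : ¬ + 2 ∣ aᵣ - a₂)
    where

    private
      h : ℕ
      h = suc (suc (length B))
      F R Z : List ℤ
      F = 0ℤ ∷ a₂ ∷ a₃ ∷ B
      R = 0ℤ ∷ a₂ ∷ a₃ ∷ Bᵣ
      Z = - a₃ ∷ - a₂ ∷ a₂ ∷ a₃ ∷ []
      T : ℤ
      T = sumℤ (a₂ ∷ a₃ ∷ B)

    open Chain a₃ Z

    sumℤ-B : sumℤ B ≡ aᵣ + sumℤ Bᵣ
    sumℤ-B = sumℤ-↭ B↭aᵣ∷Bᵣ

    0<a₃ : 0ℤ < a₃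
    0<a₃ = <-trans 0<a₂ a₂<a₃

    0≤B : All (0ℤ ≤_) B
    0≤B = All.map (λ a₃<c → <⇒≤ (<-trans 0<a₃ a₃<c)) a₃<B

    0<aᵣ : 0ℤ < aᵣ
    0<aᵣ = <-trans 0<a₃ (All.lookup a₃<B (∈-resp-↭ (↭-sym B↭aᵣ∷Bᵣ) (here refl)))

    Z-sorted : AllPairs _<_ Z
    Z-sorted = Linked⇒AllPairs <-trans
      (neg-mono-< a₂<a₃ Linked.∷ <-trans (neg-mono-< 0<a₂) 0<a₂ Linked.∷ a₂<a₃ Linked.∷ Linked.[-])

    Z-bounded : All (λ z → - a₃ ≤ z × z ≤ a₃) Z
    Z-bounded = (≤-refl , -a₃≤a₃)
      All.∷ (<⇒≤ (neg-mono-< a₂<a₃) , ≤-trans (0≤i⇒-i≤i (<⇒≤ 0<a₂)) (<⇒≤ a₂<a₃))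
      All.∷ (≤-trans (<⇒≤ (neg-mono-< a₂<a₃)) (0≤i⇒-i≤i (<⇒≤ 0<a₂)) , <⇒≤ a₂<a₃)
      All.∷ (-a₃≤a₃ , ≤-refl)
      All.∷ All.[]
      where -a₃≤a₃ = 0≤i⇒-i≤i (<⇒≤ 0<a₃)

    Z-parity : All (λ z → + 2 ∣ z - a₃) Z
    Z-parity = subst (+ 2 ∣_) (neg-distrib-+ a₃ a₃) (∣m⇒∣-m (2∣x+x a₃))
      All.∷ subst (+ 2 ∣_) -a₂-a₃ (∣m⇒∣-m (∣m∣n⇒∣m+n 2∣a₃-a₂ (2∣x+x a₂)))
      All.∷ subst (+ 2 ∣_) a₂-a₃ (∣m⇒∣-m 2∣a₃-a₂)
      All.∷ subst (+ 2 ∣_) (sym (+-inverseʳ a₃)) (divides 0ℤ refl)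
      All.∷ All.[]
      where
      -a₂-a₃ : - ((a₃ - a₂) + (a₂ + a₂)) ≡ - a₂ - a₃
      -a₂-a₃ = solve (a₂ ∷ a₃ ∷ [])
      a₂-a₃ : - (a₃ - a₂) ≡ a₂ - a₃
      a₂-a₃ = solve (a₂ ∷ a₃ ∷ [])

    a₃∈Z : a₃ ∈ Z
    a₃∈Z = there (there (there (here refl)))

    B-chain-elements : y ∈ chain (reverse B) → ∃₂ λ z s → z ∈ Z × FullSignedSum B s × y ≡ z + s
    B-chain-elements y∈ with chain-elements a₃∈Z y∈
    ... | z , s , z∈Z , f , y≡ = z , s , z∈Z , FullSignedSum-↭ (↭-reverse B) f , y≡

    B-chain-bounded : y ∈ chain (reverse B) → - (a₃ + sumℤ B) ≤ y × y ≤ a₃ + sumℤ B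
    B-chain-bounded {y} y∈ = subst (λ S → - (a₃ + S) ≤ y × y ≤ a₃ + S) (sumℤ-↭ (↭-reverse B))
      (chain-bounded a₃∈Z Z-bounded (All-resp-↭ (↭-sym (↭-reverse B)) 0≤B) y∈)

    a₃+ΣB<T : a₃ + sumℤ B < T
    a₃+ΣB<T = begin-strict
      a₃ + sumℤ B         ≡⟨ +-identityˡ _ ⟨
      0ℤ + (a₃ + sumℤ B)  <⟨ +-monoˡ-< _ 0<a₂ ⟩
      T                   ∎
      where open ≤-Reasoning

    sumℤ-R<T : sumℤ R < T
    sumℤ-R<T = begin-strict
      0ℤ + (a₂ + (a₃ + sumℤ Bᵣ))   ≡⟨ +-identityˡ _ ⟩
      a₂ + (a₃ + sumℤ Bᵣ)          ≡⟨ cong (λ t → a₂ + (a₃ + t)) (+-identityˡ (sumℤ Bᵣ)) ⟨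
      a₂ + (a₃ + (0ℤ + sumℤ Bᵣ))   <⟨ +-monoʳ-< a₂ (+-monoʳ-< a₃ (+-monoˡ-< (sumℤ Bᵣ) 0<aᵣ)) ⟩
      a₂ + (a₃ + (aᵣ + sumℤ Bᵣ))   ≡⟨ cong (λ t → a₂ + (a₃ + t)) sumℤ-B ⟨
      T                           ∎
      where open ≤-Reasoning

    extra : List ℤ
    extra = - T ∷ chain (reverse B) ++ [ T ]

    extra-sorted : AllPairs _<_ extra
    extra-sorted = All.++⁺ (All.tabulate -T<chain) (-T<T All.∷ All.[])
      ∷ AllPairs.++⁺ chain-sorted′ (All.[] ∷ []) (All.tabulate (λ y∈ → chain<T y∈ All.∷ All.[]))
      where
      chain-sorted′ : AllPairs _<_ (chain (reverse B))
      chain-sorted′ = chain-sorted a₃∈Z Z-sorted Z-bounded (AllPairs-reverse B-sorted)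
        (All-resp-↭ (↭-sym (↭-reverse B)) a₃<B)
      chain<T : y ∈ chain (reverse B) → y < T
      chain<T y∈ = ≤-<-trans (proj₂ (B-chain-bounded y∈)) a₃+ΣB<T
      -T<chain : y ∈ chain (reverse B) → - T < y
      -T<chain y∈ = <-≤-trans (neg-mono-< a₃+ΣB<T) (proj₁ (B-chain-bounded y∈))
      -T<T : - T < T
      -T<T = <-trans (neg-mono-< a₃+ΣB<T) (≤-<-trans (0≤i⇒-i≤i 0≤a₃+ΣB) a₃+ΣB<T)
        where 0≤a₃+ΣB = +-mono-≤ (<⇒≤ 0<a₃) (sumℤ-nonNeg 0≤B)

    -- 0 is added as an h-th summand.
    ∈-signedSums-F : ∀ {b} → b ∷ B ⊑ a₂ ∷ a₃ ∷ B → FullSignedSum (b ∷ B) x → x ∈ signedSums h F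
    ∈-signedSums-F {x} b∷B⊑ f = subst (_∈ signedSums h F) (+-identityˡ x) (∈-signedSums⁺ (refl ∷ˢ b∷B⊑) (+∷_ {0ℤ} f))

    extra⊆sums-F : extra ⊆ signedSums h F
    extra⊆sums-F (here refl) = ∈-signedSums⁺ (0ℤ ∷ʳ ⊆-refl) (FullSignedSum-neg-sum (a₂ ∷ a₃ ∷ B))
    extra⊆sums-F (there y∈) with ∈-++⁻ (chain (reverse B)) y∈
    ... | inj₂ (here refl) = ∈-signedSums⁺ (0ℤ ∷ʳ ⊆-refl) (FullSignedSum-sum (a₂ ∷ a₃ ∷ B))
    ... | inj₁ y∈chain with B-chain-elements y∈chain
    ...   | _ , _ , here refl , f , refl                         = ∈-signedSums-F (a₂ ∷ʳ ⊆-refl) (-∷ f)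
    ...   | _ , _ , there (here refl) , f , refl                 = ∈-signedSums-F (refl ∷ˢ a₃ ∷ʳ ⊆-refl) (-∷ f)
    ...   | _ , _ , there (there (here refl)) , f , refl         = ∈-signedSums-F (refl ∷ˢ a₃ ∷ʳ ⊆-refl) (+∷ f)
    ...   | _ , _ , there (there (there (here refl))) , f , refl = ∈-signedSums-F (a₂ ∷ʳ ⊆-refl) (+∷ f)

    R-sums-full : x ∈ signedSums h R → FullSignedSum R x
    R-sums-full {x} x∈ = ∈-signedSums-full⁻ (subst (λ k → x ∈ signedSums k R) h≡|R| x∈)
      where h≡|R| = cong (suc ∘ suc) (↭-length B↭aᵣ∷Bᵣ)

    R-sums-bounded : x ∈ signedSums h R → - sumℤ R ≤ x × x ≤ sumℤ R
    R-sums-bounded x∈ = FullSignedSum-bounded 0≤R (R-sums-full x∈)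
      where
      0≤R : All (0ℤ ≤_) R
      0≤R = ≤-refl All.∷ <⇒≤ 0<a₂ All.∷ <⇒≤ 0<a₃ All.∷ All-resp-⊑ Bᵣ⊑B 0≤B

    chain∉R : ∀ {z} → z ∈ Z → FullSignedSum B s → ¬ FullSignedSum R (z + s)
    chain∉R {s} {z} z∈Z f g = 2∤aᵣ-a₂ (subst (+ 2 ∣_) difference
      (∣m∣n⇒∣m-n (∣m∣n⇒∣m-n (FullSignedSum-parity f) (FullSignedSum-parity g)) (All.lookup Z-parity z∈Z)))
      where
      regroup : ∀ a₂ a₃ aᵣ S s z → ((aᵣ + S - s) - (0ℤ + (a₂ + (a₃ + S)) - (z + s))) - (z - a₃) ≡ aᵣ - a₂
      regroup = solve-∀
      difference : ((sumℤ B - s) - (sumℤ R - (z + s))) - (z - a₃) ≡ aᵣ - a₂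
      difference rewrite sumℤ-B = regroup a₂ a₃ aᵣ (sumℤ Bᵣ) s z

    sums-R∩extra=∅ : Disjoint (signedSums h R) extra
    sums-R∩extra=∅ (x∈R , here refl) = <⇒≱ sumℤ-R<T (neg-cancel-≤ (proj₁ (R-sums-bounded x∈R)))
    sums-R∩extra=∅ (x∈R , there x∈) with ∈-++⁻ (chain (reverse B)) x∈
    ... | inj₂ (here refl) = <⇒≱ sumℤ-R<T (proj₂ (R-sums-bounded x∈R))
    ... | inj₁ x∈chain with B-chain-elements x∈chain
    ...   | _ , _ , z∈Z , f , refl = chain∉R z∈Z f (R-sums-full x∈R)

    length-extra : length extra ≡ 2 ℕ.+ (4 ℕ.* suc (length B) ℕ.+ length B C 2)
    length-extra = begin
      suc (length (chain (reverse B) ++ [ T ]))  ≡⟨ cong suc (List.length-++ (chain (reverse B))) ⟩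
      suc (length (chain (reverse B)) ℕ.+ 1)     ≡⟨ cong suc (ℕ.+-comm _ 1) ⟩
      2 ℕ.+ length (chain (reverse B))           ≡⟨ cong (2 ℕ.+_) (length-chain (reverse B)) ⟩
      2 ℕ.+ (4 ℕ.* suc (length (reverse B)) ℕ.+ length (reverse B) C 2)
        ≡⟨ cong (λ k → 2 ℕ.+ (4 ℕ.* suc k ℕ.+ k C 2)) (List.length-reverse B) ⟩
      2 ℕ.+ (4 ℕ.* suc (length B) ℕ.+ length B C 2) ∎
      where open ≡-Reasoning

    card-R+gain≤card-F : card-hSignedSumset h R ℕ.+ (2 ℕ.+ (4 ℕ.* suc (length B) ℕ.+ length B C 2))
                     ℕ.≤ card-hSignedSumset h F
    card-R+gain≤card-F = subst (λ k → card-hSignedSumset h R ℕ.+ k ℕ.≤ card-hSignedSumset h F) length-extra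
      (deduplicate-length-+ ℤ._≟_ (AllPairs.map <⇒≢ extra-sorted) extra⊆sums-F sums-R∩extra=∅
        (signedSums-⊑ {R} {F} {h} (refl ∷ˢ refl ∷ˢ refl ∷ˢ Bᵣ⊑B)))


open import Data.Nat using (ℕ; suc; _≤_; _<_; _+_; _*_; _∸_; _^_)
open import Data.Integer.Divisibility using (_∣_)

[n+1]C2*2≡[n+1]*n : ∀ n → (suc n C 2) * 2 ≡ suc n * n
[n+1]C2*2≡[n+1]*n 0       = refl
[n+1]C2*2≡[n+1]*n (suc n) = begin
  (suc (suc n) C 2) * 2        ≡⟨ cong (_* 2) ([n+1]C2≡n+nC2 (suc n)) ⟩
  (suc n + suc n C 2) * 2      ≡⟨ ℕ.*-distribʳ-+ 2 (suc n) (suc n C 2) ⟩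
  suc n * 2 + (suc n C 2) * 2  ≡⟨ cong (λ t → suc n * 2 + t) ([n+1]C2*2≡[n+1]*n n) ⟩
  suc n * 2 + suc n * n        ≡⟨ ℕ.*-distribˡ-+ (suc n) 2 n ⟨
  suc n * (2 + n)              ≡⟨ ℕ.*-comm (suc n) (2 + n) ⟩
  suc (suc n) * suc n          ∎
  where open ≡-Reasoning

h*[h∸1]/2≡hC2 : ∀ n → suc n * n / 2 ≡ suc n C 2
h*[h∸1]/2≡hC2 n = trans (cong (_/ 2) (sym ([n+1]C2*2≡[n+1]*n n))) (m*n/n≡m (suc n C 2) 2)

gain-count : ∀ c m → c + suc (suc m) * suc m / 2 + 2 * suc (suc m) + 1 ≡ c + (2 + (4 * suc m + m C 2))
gain-count c m = begin
  c + suc (suc m) * suc m / 2 + 2 * suc (suc m) + 1  ≡⟨ cong (λ t → c + t + 2 * suc (suc m) + 1) pairs ⟩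
  c + (suc m + (m + m C 2)) + 2 * suc (suc m) + 1     ≡⟨ regroup c m (m C 2) ⟩
  c + (2 + (4 * suc m + m C 2))                       ∎
  where
  open ≡-Reasoning
  pairs : suc (suc m) * suc m / 2 ≡ suc m + (m + m C 2)
  pairs = trans (h*[h∸1]/2≡hC2 (suc m)) (trans ([n+1]C2≡n+nC2 (suc m)) (cong (λ t → suc m + t) ([n+1]C2≡n+nC2 m)))
  regroup : ∀ c m x → c + (suc m + (m + x)) + 2 * suc (suc m) + 1 ≡ c + (2 + (4 * suc m + x))
  regroup = ℕ-Solver.solve-∀

total-count : ∀ k → (4 + k) ^ 2 + (4 + k) + 2 ≡ (4 + k + (3 + k) C 2) + (2 + (4 * (3 + k) + (2 + k) C 2))
total-count k = begin
  (4 + k) ^ 2 + (4 + k) + 2                               ≡⟨ expand k ⟩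
  6 * k + 20 + (2 + k) * (1 + k)                          ≡⟨ cong (λ t → 6 * k + 20 + t) ([n+1]C2*2≡[n+1]*n (1 + k)) ⟨
  6 * k + 20 + ((2 + k) C 2) * 2                          ≡⟨ regroup k ((2 + k) C 2) ⟩
  (4 + k + (2 + k + (2 + k) C 2)) + (2 + (4 * (3 + k) + (2 + k) C 2))
    ≡⟨ cong (λ t → (4 + k + t) + (2 + (4 * (3 + k) + (2 + k) C 2))) ([n+1]C2≡n+nC2 (2 + k)) ⟨
  (4 + k + (3 + k) C 2) + (2 + (4 * (3 + k) + (2 + k) C 2)) ∎
  where
  open ≡-Reasoning
  -- the solver does not know _^_; (4 + k) ^ 2 unfolds to the left-hand side below
  expand : ∀ k → (4 + k) * ((4 + k) * 1) + (4 + k) + 2 ≡ 6 * k + 20 + (2 + k) * (1 + k)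
  expand = ℕ-Solver.solve-∀
  regroup : ∀ k x → 6 * k + 20 + x * 2 ≡ (4 + k + (2 + k + x)) + (2 + (4 * (3 + k) + x))
  regroup = ℕ-Solver.solve-∀

steps⇒increasing : ∀ {N} (a : ℕ → ℤ) → (∀ i → 1 ≤ i → i < N → a i ℤ.< a (suc i)) →
  ∀ {i j} → 1 ≤ i → i < j → j ≤ N → a i ℤ.< a j
steps⇒increasing a step {i} {suc j} 1≤i (ℕ.s≤s i≤j) j<N with ℕ.m≤n⇒m<n∨m≡n i≤j
... | inj₁ i<j  = ℤ.<-trans (steps⇒increasing a step 1≤i i<j (ℕ.<⇒≤ j<N)) (step j (ℕ.≤-trans 1≤i (ℕ.<⇒≤ i<j)) j<N)
... | inj₂ refl = step i 1≤i j<N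

applyUpTo-suc-increasing : ∀ {N} (a : ℕ → ℤ) → (∀ i → 1 ≤ i → i < N → a i ℤ.< a (suc i)) →
  AllPairs (λ i j → a i ℤ.< a j) (applyUpTo suc N)
applyUpTo-suc-increasing {N} a step =
  AllPairs.applyUpTo⁺₁ suc N (λ i<j j<N → steps⇒increasing a step (ℕ.s≤s ℕ.z≤n) (ℕ.s≤s i<j) j<N)

filter-≢-prefix : ∀ {r} → 4 ≤ r → ∀ I →
  filter (λ i → ¬? (i ℕ.≟ r)) (1 ∷ 2 ∷ 3 ∷ I) ≡ 1 ∷ 2 ∷ 3 ∷ filter (λ i → ¬? (i ℕ.≟ r)) I
filter-≢-prefix {r} 4≤r I = trans (List.filter-++ P? (1 ∷ 2 ∷ 3 ∷ []) I)
  (cong (_++ filter P? I) (List.filter-all P? (≢r 1<4 All.∷ ≢r 2<4 All.∷ ≢r 3<4 All.∷ All.[])))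
  where
  P? = λ i → ¬? (i ℕ.≟ r)
  ≢r : ∀ {j} → j < 4 → j ≢ r
  ≢r j<4 refl = ℕ.<-irrefl refl (ℕ.<-≤-trans j<4 4≤r)
  1<4 : 1 < 4
  1<4 = ℕ.s≤s (ℕ.s≤s ℕ.z≤n)
  2<4 : 2 < 4
  2<4 = ℕ.s≤s (ℕ.s≤s (ℕ.s≤s ℕ.z≤n))
  3<4 : 3 < 4
  3<4 = ℕ.≤-refl

upTo-prefix : ∀ m → map suc (upTo (3 + m)) ≡ 1 ∷ 2 ∷ 3 ∷ applyUpTo (λ i → 4 + i) m
upTo-prefix m = List.map-upTo suc (3 + m)

module Sequence (k : ℕ) (a : ℕ → ℤ) (a₁≡0 : a 1 ≡ + 0) (a-step : ∀ i → 1 ≤ i → i < 5 + k → a i ℤ.< a (suc i))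
  {r} (4≤r : 4 ≤ r) (r≤5+k : r ≤ 5 + k) where

  private
    P? = λ i → ¬? (i ℕ.≟ r)
    I : List ℕ
    I = applyUpTo (λ i → 4 + i) (2 + k)

  B Bᵣ : List ℤ
  B  = map a I
  Bᵣ = map a (filter P? I)

  F≡ : map a (map suc (upTo (5 + k))) ≡ + 0 ∷ a 2 ∷ a 3 ∷ B
  F≡ = trans (cong (map a) (upTo-prefix (2 + k))) (cong (_∷ a 2 ∷ a 3 ∷ B) a₁≡0)

  R≡ : map a (filter P? (map suc (upTo (5 + k)))) ≡ + 0 ∷ a 2 ∷ a 3 ∷ Bᵣ
  R≡ = trans (cong (map a ∘ filter P?) (upTo-prefix (2 + k)))
         (trans (cong (map a) (filter-≢-prefix 4≤r I)) (cong (_∷ a 2 ∷ a 3 ∷ Bᵣ) a₁≡0))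

  private
    increasing : AllPairs (λ i j → a i ℤ.< a j) (1 ∷ 2 ∷ 3 ∷ I)
    increasing = applyUpTo-suc-increasing a a-step
    I-increasing = AllPairs.tail (AllPairs.tail (AllPairs.tail increasing))
    increasingᵣ : AllPairs (λ i j → a i ℤ.< a j) (1 ∷ 2 ∷ 3 ∷ filter P? I)
    increasingᵣ = subst (AllPairs _) (filter-≢-prefix 4≤r I) (AllPairs.filter⁺ P? increasing)
    r∈I : r ∈ I
    r∈I = subst (_∈ I) (ℕ.m+[n∸m]≡n 4≤r) (∈-applyUpTo⁺ (λ i → 4 + i) (ℕ.s≤s (ℕ.∸-monoˡ-≤ 4 r≤5+k)))
    I↭r∷Iᵣ : I ↭ r ∷ filter P? I
    I↭r∷Iᵣ = ↭-∷-filter-≢ ℕ._≟_ (AllPairs.map (λ aᵢ<aⱼ i≡j → ℤ.<-irrefl (cong a i≡j) aᵢ<aⱼ) I-increasing) r∈I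

  0<a₂ : + 0 ℤ.< a 2
  0<a₂ = subst (ℤ._< a 2) a₁≡0 (All.head (AllPairs.head increasing))

  a₂<a₃ : a 2 ℤ.< a 3
  a₂<a₃ = All.head (AllPairs.head (AllPairs.tail increasing))

  B-sorted : AllPairs ℤ._<_ B
  B-sorted = AllPairs.map⁺ I-increasing

  a₃<B : All (a 3 ℤ.<_) B
  a₃<B = All.map⁺ (AllPairs.head (AllPairs.tail (AllPairs.tail increasing)))

  Bᵣ⊑B : Bᵣ ⊑ B
  Bᵣ⊑B = Sublist.map⁺ a (filter-⊆ P? I)

  B↭aᵣ∷Bᵣ : B ↭ a r ∷ Bᵣ
  B↭aᵣ∷Bᵣ = ↭.map⁺ a I↭r∷Iᵣ

  a₂a₃Bᵣ-sorted : AllPairs ℤ._<_ (a 2 ∷ a 3 ∷ Bᵣ)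
  a₂a₃Bᵣ-sorted = AllPairs.map⁺ (AllPairs.tail increasingᵣ)

  a₂a₃Bᵣ-positive : All (+ 0 ℤ.<_) (a 2 ∷ a 3 ∷ Bᵣ)
  a₂a₃Bᵣ-positive = All.map⁺ (All.map (λ {i} → subst (ℤ._< a i) a₁≡0) (AllPairs.head increasingᵣ))

  |B| : length B ≡ 2 + k
  |B| = trans (List.length-map a I) (List.length-applyUpTo (λ i → 4 + i) (2 + k))

  |Bᵣ| : length Bᵣ ≡ 1 + k
  |Bᵣ| = ℕ.suc-injective (trans (sym (↭-length B↭aᵣ∷Bᵣ)) |B|)

lemma2p6 : (h : ℕ) → 4 ≤ h → (a : ℕ → ℤ) →
    a 1 ≡ + 0 →
    (∀ i → 1 ≤ i → i < suc h → a i ℤ.< a (suc i)) →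
    (+ 2) ∣ (a 3 - a 2) →
    (r : ℕ) → 4 ≤ r → r ≤ suc h → ¬ ((+ 2) ∣ (a r - a 2)) →
    (card-hSignedSumset h (map a (map suc (upTo (suc h))))
    ℕ.≥ card-hSignedSumset h (map a (filter (λ i → ¬? (i ℕ.≟ r)) (map suc (upTo (suc h)))))
    + (h * (h ∸ 1)) / 2 + 2 * h + 1)
    × (card-hSignedSumset h (map a (map suc (upTo (suc h)))) ℕ.≥ h ^ 2 + h + 2)
lemma2p6 h@(suc (suc (suc (suc k)))) (ℕ.s≤s (ℕ.s≤s (ℕ.s≤s (ℕ.s≤s _)))) a a₁≡0 a-step 2∣a₃-a₂ r 4≤r r≤h+1 2∤aᵣ-a₂ =
  subst₂ (λ F R → (card-hSignedSumset h F ℕ.≥ card-hSignedSumset h R + (h * (h ∸ 1)) / 2 + 2 * h + 1)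
                × (card-hSignedSumset h F ℕ.≥ h ^ 2 + h + 2))
    (sym F≡) (sym R≡)
    ( ℕ.≤-trans (ℕ.≤-reflexive (gain-count (card-hSignedSumset h R) (2 + k))) gain
    , ℕ.≤-trans (ℕ.≤-reflexive (total-count k)) (ℕ.≤-trans (ℕ.+-monoˡ-≤ _ lower) gain))
  where
  open Sequence k a a₁≡0 a-step 4≤r r≤h+1
  open OppositeParity 0<a₂ a₂<a₃ B-sorted a₃<B Bᵣ⊑B B↭aᵣ∷Bᵣ (Signed.∣ᵤ⇒∣ 2∣a₃-a₂) (2∤aᵣ-a₂ ∘ Signed.∣⇒∣ᵤ)
  F R : List ℤ
  F = + 0 ∷ a 2 ∷ a 3 ∷ B
  R = + 0 ∷ a 2 ∷ a 3 ∷ Bᵣ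

  gain : card-hSignedSumset h R + (2 + (4 * (3 + k) + (2 + k) C 2)) ≤ card-hSignedSumset h F
  gain = subst (λ m → card-hSignedSumset (2 + m) R + (2 + (4 * suc m + m C 2)) ≤ card-hSignedSumset (2 + m) F)
    |B| card-R+gain≤card-F

  lower : h + (3 + k) C 2 ≤ card-hSignedSumset h R
  lower = subst (λ m → 3 + m + (2 + m) C 2 ≤ card-hSignedSumset (3 + m) R)
    |Bᵣ| (card-hSignedSumset-0∷-≥ a₂a₃Bᵣ-sorted a₂a₃Bᵣ-positive)
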